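{- Let $q$ and $s$ be indeterminates and consider linear operators on the space of polynomials in $x$. Let $X$ be multiplication by $x$ and $D_q$ the $q$-differentiation operator $D_qf(x)=\frac{f(qx)-f(x)}{(q-1)x}$. Then for every $n\ge0$, $$(X+qsD_q)(X+q^3sD_q)\cdots(X+q^{2n-1}sD_q)=\sum_{m=0}^n\sum_{j=0}^{\min(m,n-m)}\frac{q^{n^2+j^2-(m+j)n}\,[n]!\,s^{n-m}}{(1+q)(1+q^2)\cdots(1+q^j)\,[j]!\,[m-j]!\,[n-m-j]!}\,X^{m-j}D_q^{n-m-j}.$$
   Context: Notation: $[n]=1+q+\cdots+q^{n-1}$, $[n]!=[1][2]\cdots[n]$ with $[0]!=1$; the product $(1+q)\cdots(1+q^j)$ equals $1$ for $j=0$. $X^aD_q^b$ denotes $b$ applications of $D_q$ followed by multiplication by $x^a$. -}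

module Defs where

open import Level using (Level; _⊔_)
open import Data.Nat as ℕ using (ℕ; zero; suc; _∸_; _≤_; _⊓_)
open import Data.Product using (∃; _×_)
open import Relation.Nullary using (¬_)
open import Algebra.Bundles using (CommutativeRing)

record Field (c ℓ : Level) : Set (Level.suc (c ⊔ ℓ)) where
  field
    commRing : CommutativeRing c ℓ
  open CommutativeRing commRing public
  field
    _⁻¹     : Carrier → Carrier
    0≉1     : ¬ (0# ≈ 1#)
    ⁻¹-inverse : ∀ x → ¬ (x ≈ 0#) → x * (x ⁻¹) ≈ 1#

module Ops {c ℓ} (K : Field c ℓ) (q : Field.Carrier K) where
  open Field K

  pow : Carrier → ℕ → Carrier
  pow a zero    = 1#
  pow a (suc n) = pow a n * a

  qint : ℕ → Carrier
  qint zero    = 0#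
  qint (suc n) = qint n + pow q n

  qfact : ℕ → Carrier
  qfact zero    = 1#
  qfact (suc n) = qfact n * qint (suc n)

  onePlusProd : ℕ → Carrier
  onePlusProd zero    = 1#
  onePlusProd (suc j) = onePlusProd j * (1# + pow q (suc j))

  -- Polynomials in x with coefficients in K: coefficient sequences
  -- (coefficient of x^k at index k) with finite support.
  Seq : Set c
  Seq = ℕ → Carrier

  IsPolynomial : Seq → Set ℓ
  IsPolynomial f = ∃ λ N → ∀ k → N ≤ k → f k ≈ 0#

  Op : Set c
  Op = Seq → Seq

  X : Op
  X f zero    = 0#
  X f (suc k) = f k

  -- D_q : q-derivative, (D_q f)(x) = (f(qx) - f(x)) / ((q-1)x);
  -- on monomials D_q x^(k+1) = [k+1] x^k, D_q 1 = 0.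
  Dq : Op
  Dq f k = qint (suc k) * f (suc k)

  idOp : Op
  idOp f = f

  _∘Op_ : Op → Op → Op
  (A ∘Op B) f = A (B f)

  _+Op_ : Op → Op → Op
  (A +Op B) f k = A f k + B f k

  _·Op_ : Carrier → Op → Op
  (a ·Op A) f k = a * A f k

  zeroOp : Op
  zeroOp f k = 0#

  iter : ℕ → Op → Op
  iter zero    A = idOp
  iter (suc n) A = A ∘Op iter n A

  XD : ℕ → ℕ → Op
  XD a b = iter a X ∘Op iter b Dq

  sumOp : ℕ → (ℕ → Op) → Op
  sumOp zero    F = F 0
  sumOp (suc n) F = sumOp n F +Op F (suc n)

module Cor3 {c ℓ} (K : Field c ℓ) (q s : Field.Carrier K) where
  open Field K
  open Ops K q

  -- factor X + q^(2i-1) s D_q, for i ≥ 1 (given as i = suc i')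
  factor : ℕ → Op
  factor i' = X +Op ((pow q (ℕ._+_ (ℕ._*_ 2 i') 1) * s) ·Op Dq)

  lhs : ℕ → Op
  lhs zero    = idOp
  lhs (suc n) = lhs n ∘Op factor n

  coeff : ℕ → ℕ → ℕ → Carrier
  coeff n m j =
    (pow q ((ℕ._+_ (ℕ._*_ n n) (ℕ._*_ j j)) ∸ ℕ._*_ (ℕ._+_ m j) n)
       * qfact n * pow s (n ∸ m))
    * (onePlusProd j * qfact j * qfact (m ∸ j) * qfact (n ∸ m ∸ j)) ⁻¹

  rhs : ℕ → Op
  rhs n = sumOp n λ m → sumOp (m ⊓ (n ∸ m)) λ j →
            coeff n m j ·Op XD (m ∸ j) (n ∸ m ∸ j)

module Submission where

open import Defs
open import Level using (_⊔_)
open import Data.Nat using (ℕ; zero; suc; pred; _+_; _*_; _∸_; _≤_; _<_; _⊓_; z≤n; s≤s; s≤s⁻¹; _≤?_)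
import Data.Nat.Properties as ℕₚ
open import Data.Product using (_×_; _,_)
open import Data.Sum using (_⊎_; inj₁; inj₂)
open import Relation.Nullary using (¬_; yes; no)
open import Relation.Nullary.Negation using (contradiction)
import Relation.Binary.PropositionalEquality as P
open P using (_≡_)
open import Data.Nat.Tactic.RingSolver using (solve-∀)
import Algebra.Solver.Ring.NaturalCoefficients.Default as NaturalCoefficients
import Relation.Binary.Reasoning.Setoid as SetoidReasoning

-- The product (X + q s D_q)(X + q^3 s D_q)⋯(X + q^(2n-1) s D_q) is expanded
-- in the monomials X^(m-j) D_q^(n-m-j).  The only operator fact needed is
-- the q-commutation rule D_q X = q X D_q + 1, which gives
--   X^a D_q^b (X + c D_q) = q^b X^(a+1) D_q^b + [b] X^a D_q^(b-1) + c X^a D_q^(b+1).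
-- Hence the coefficients E n m j of the expansion satisfy a three-term
-- recursion in n (module Expansion), and vanish outside j ≤ m, m + j ≤ n.
-- By induction on n, using the q-Pascal identity
--   q^b [a] + q^(a+b) [2j] + q^(a+2j+b) [b] = q^b [a+2j+b],
-- the recursion is solved in closed form, multiplied out by its denominator
-- (module ClosedForm).  When [k] ≠ 0 and 1 + q^k ≠ 0 the denominator can be
-- divided out, identifying E n m j with the coefficient of the theorem, and
-- cutting the sums down to j ≤ min(m, n-m) yields the right-hand side.
-- The identity holds coefficientwise on all sequences, not only polynomials.
--
-- Field operations are written _⊕_ and _⊗_ so that _+_ and _*_ remain the
-- arithmetic of indices in ℕ.

module FieldFacts {c ℓ} (K : Field c ℓ) where
  open Field K renaming (_+_ to _⊕_; _*_ to _⊗_)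
  open SetoidReasoning setoid
  open NaturalCoefficients commutativeSemiring using (solve; _:*_; _:=_)

  1≉0 : ¬ 1# ≈ 0#
  1≉0 e = 0≉1 (sym e)

  ⊗-nonzero : ∀ {x y} → ¬ x ≈ 0# → ¬ y ≈ 0# → ¬ (x ⊗ y) ≈ 0#
  ⊗-nonzero {x} {y} x≉0 y≉0 xy≈0 = y≉0 (begin
    y                 ≈⟨ sym (*-identityˡ y) ⟩
    1# ⊗ y            ≈⟨ *-congʳ (sym (⁻¹-inverse x x≉0)) ⟩
    (x ⊗ x ⁻¹) ⊗ y    ≈⟨ solve 3 (λ x i y → (x :* i) :* y := i :* (x :* y)) refl x (x ⁻¹) y ⟩
    x ⁻¹ ⊗ (x ⊗ y)    ≈⟨ *-congˡ xy≈0 ⟩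
    x ⁻¹ ⊗ 0#         ≈⟨ zeroʳ _ ⟩
    0#                ∎)

  divide : ∀ {d e v} → ¬ d ≈ 0# → d ⊗ e ≈ v → e ≈ v ⊗ d ⁻¹
  divide {d} {e} {v} d≉0 de≈v = begin
    e                 ≈⟨ sym (*-identityʳ e) ⟩
    e ⊗ 1#            ≈⟨ *-congˡ (sym (⁻¹-inverse d d≉0)) ⟩
    e ⊗ (d ⊗ d ⁻¹)    ≈⟨ solve 3 (λ e d i → e :* (d :* i) := (d :* e) :* i) refl e d (d ⁻¹) ⟩
    (d ⊗ e) ⊗ d ⁻¹    ≈⟨ *-congʳ de≈v ⟩
    v ⊗ d ⁻¹          ∎

module QCalculus {c ℓ} (K : Field c ℓ) (q : Field.Carrier K) where
  open Field K renaming (_+_ to _⊕_; _*_ to _⊗_)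
  open Ops K q
  open SetoidReasoning setoid
  open NaturalCoefficients commutativeSemiring using (solve; _:+_; _:*_; _:=_; con)

  ≡⇒≈ : ∀ {x y} → x ≡ y → x ≈ y
  ≡⇒≈ P.refl = refl

  pow-+ : ∀ x m n → pow x (m + n) ≈ pow x m ⊗ pow x n
  pow-+ x zero    n = sym (*-identityˡ _)
  pow-+ x (suc m) n = begin
    pow x (m + n) ⊗ x          ≈⟨ *-congʳ (pow-+ x m n) ⟩
    (pow x m ⊗ pow x n) ⊗ x    ≈⟨ solve 3 (λ a b y → (a :* b) :* y := (a :* y) :* b) refl (pow x m) (pow x n) x ⟩
    (pow x m ⊗ x) ⊗ pow x n    ∎

  qint-+ : ∀ m n → qint (m + n) ≈ qint m ⊕ pow q m ⊗ qint n
  qint-+ m zero = begin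
    qint (m + 0)               ≡⟨ P.cong qint (ℕₚ.+-identityʳ m) ⟩
    qint m                     ≈⟨ sym (trans (+-congˡ (zeroʳ _)) (+-identityʳ _)) ⟩
    qint m ⊕ pow q m ⊗ 0#      ∎
  qint-+ m (suc n) = begin
    qint (m + suc n)                                   ≡⟨ P.cong qint (ℕₚ.+-suc m n) ⟩
    qint (m + n) ⊕ pow q (m + n)                       ≈⟨ +-cong (qint-+ m n) (pow-+ q m n) ⟩
    (qint m ⊕ pow q m ⊗ qint n) ⊕ pow q m ⊗ pow q n    ≈⟨ solve 4 (λ a b c d → (a :+ b :* c) :+ b :* d := a :+ b :* (c :+ d))
                                                            refl (qint m) (pow q m) (qint n) (pow q n) ⟩
    qint m ⊕ pow q m ⊗ (qint n ⊕ pow q n)              ∎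

  qint-suc : ∀ k → qint (suc k) ≈ 1# ⊕ q ⊗ qint k
  qint-suc k = begin
    qint (1 + k)                   ≈⟨ qint-+ 1 k ⟩
    (0# ⊕ 1#) ⊕ (1# ⊗ q) ⊗ qint k  ≈⟨ +-cong (+-identityˡ _) (*-congʳ (*-identityˡ _)) ⟩
    1# ⊕ q ⊗ qint k                ∎

  qint-double : ∀ j → (1# ⊕ pow q j) ⊗ qint j ≈ qint (j + j)
  qint-double j = begin
    (1# ⊕ pow q j) ⊗ qint j        ≈⟨ solve 2 (λ p Q → (con 1 :+ p) :* Q := Q :+ p :* Q) refl (pow q j) (qint j) ⟩
    qint j ⊕ pow q j ⊗ qint j      ≈⟨ sym (qint-+ j j) ⟩
    qint (j + j)                   ∎

  q-pascal : ∀ a j b →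
    (qint a ⊗ pow q b ⊕ qint (j + j) ⊗ pow q (a + b)) ⊕ pow q (a + (j + j) + b) ⊗ qint b
      ≈ pow q b ⊗ qint (a + (j + j) + b)
  q-pascal a j b = begin
    (qint a ⊗ pow q b ⊕ qint (j + j) ⊗ pow q (a + b)) ⊕ pow q (a + (j + j) + b) ⊗ qint b
      ≈⟨ +-cong (+-congˡ (*-congˡ (pow-+ q a b))) (*-congʳ (pow-+ q (a + (j + j)) b)) ⟩
    (qint a ⊗ pow q b ⊕ qint (j + j) ⊗ (pow q a ⊗ pow q b)) ⊕ (pow q (a + (j + j)) ⊗ pow q b) ⊗ qint b
      ≈⟨ solve 6 (λ Qa Pb Q2j Pa R Qb → (Qa :* Pb :+ Q2j :* (Pa :* Pb)) :+ (R :* Pb) :* Qb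
                                     := Pb :* ((Qa :+ Pa :* Q2j) :+ R :* Qb))
           refl (qint a) (pow q b) (qint (j + j)) (pow q a) (pow q (a + (j + j))) (qint b) ⟩
    pow q b ⊗ ((qint a ⊕ pow q a ⊗ qint (j + j)) ⊕ pow q (a + (j + j)) ⊗ qint b)
      ≈⟨ *-congˡ (sym (trans (qint-+ (a + (j + j)) b) (+-congʳ (qint-+ a (j + j))))) ⟩
    pow q b ⊗ qint (a + (j + j) + b)
      ∎

module Sums {c ℓ} (K : Field c ℓ) where
  open Field K renaming (_+_ to _⊕_; _*_ to _⊗_)
  open NaturalCoefficients commutativeSemiring using (solve; _:+_; _:=_)

  Sum : ℕ → (ℕ → Carrier) → Carrier
  Sum zero    F = F 0
  Sum (suc N) F = Sum N F ⊕ F (suc N)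

  Sum-cong≤ : ∀ N {F G} → (∀ i → i ≤ N → F i ≈ G i) → Sum N F ≈ Sum N G
  Sum-cong≤ zero    e = e 0 z≤n
  Sum-cong≤ (suc N) e = +-cong (Sum-cong≤ N (λ i i≤N → e i (ℕₚ.m≤n⇒m≤1+n i≤N))) (e (suc N) ℕₚ.≤-refl)

  Sum-cong : ∀ N {F G} → (∀ i → F i ≈ G i) → Sum N F ≈ Sum N G
  Sum-cong N e = Sum-cong≤ N (λ i _ → e i)

  Sum-+ : ∀ N F G → Sum N (λ i → F i ⊕ G i) ≈ Sum N F ⊕ Sum N G
  Sum-+ zero    F G = refl
  Sum-+ (suc N) F G = trans (+-congʳ (Sum-+ N F G))
    (solve 4 (λ a b c d → (a :+ b) :+ (c :+ d) := (a :+ c) :+ (b :+ d)) refl _ _ _ _)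

  Sum-zero : ∀ N {F} → (∀ i → F i ≈ 0#) → Sum N F ≈ 0#
  Sum-zero zero    e = e 0
  Sum-zero (suc N) e = trans (+-cong (Sum-zero N e) (e (suc N))) (+-identityˡ 0#)

  Sum-shift : ∀ N F → Sum (suc N) F ≈ F 0 ⊕ Sum N (λ i → F (suc i))
  Sum-shift zero    F = refl
  Sum-shift (suc N) F = trans (+-congʳ (Sum-shift N F)) (+-assoc _ _ _)

  Sum-drop-first : ∀ N {F} → F 0 ≈ 0# → Sum (suc N) F ≈ Sum N (λ i → F (suc i))
  Sum-drop-first N {F} F0≈0 = trans (Sum-shift N F) (trans (+-congʳ F0≈0) (+-identityˡ _))

  Sum-drop-last : ∀ N {F} → F (suc N) ≈ 0# → Sum (suc N) F ≈ Sum N F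
  Sum-drop-last N F[N+1]≈0 = trans (+-congˡ F[N+1]≈0) (+-identityʳ _)

  Sum-truncate : ∀ {M} N {F} → M ≤ N → (∀ i → M < i → F i ≈ 0#) → Sum N F ≈ Sum M F
  Sum-truncate zero    z≤n _ = refl
  Sum-truncate (suc N) M≤1+N vanish with ℕₚ.m≤n⇒m<n∨m≡n M≤1+N
  ... | inj₂ P.refl = refl
  ... | inj₁ M<1+N  = trans (Sum-drop-last N (vanish (suc N) M<1+N)) (Sum-truncate N (s≤s⁻¹ M<1+N) vanish)

module Operators {c ℓ} (K : Field c ℓ) (q : Field.Carrier K) where
  open Field K renaming (_+_ to _⊕_; _*_ to _⊗_)
  open Ops K q
  open QCalculus K q using (qint-suc)
  open SetoidReasoning setoid
  open NaturalCoefficients commutativeSemiring using (solve; _:+_; _:*_; _:=_; con)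

  _≐_ : Seq → Seq → Set ℓ
  f ≐ g = ∀ k → f k ≈ g k

  record IsLinear (A : Op) : Set (c ⊔ ℓ) where
    field
      cong        : ∀ {f g} → f ≐ g → A f ≐ A g
      additive    : ∀ f g → A (λ k → f k ⊕ g k) ≐ (λ k → A f k ⊕ A g k)
      homogeneous : ∀ a f → A (λ k → a ⊗ f k) ≐ (λ k → a ⊗ A f k)

  X-linear : IsLinear X
  X-linear = record { cong = cong; additive = additive; homogeneous = homogeneous }
    where
    cong : ∀ {f g} → f ≐ g → X f ≐ X g
    cong f≐g zero    = refl
    cong f≐g (suc k) = f≐g k
    additive : ∀ f g → X (λ k → f k ⊕ g k) ≐ (λ k → X f k ⊕ X g k)
    additive f g zero    = sym (+-identityˡ 0#)
    additive f g (suc k) = refl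
    homogeneous : ∀ a f → X (λ k → a ⊗ f k) ≐ (λ k → a ⊗ X f k)
    homogeneous a f zero    = sym (zeroʳ a)
    homogeneous a f (suc k) = refl

  Dq-linear : IsLinear Dq
  Dq-linear = record
    { cong        = λ f≐g k → *-congˡ (f≐g (suc k))
    ; additive    = λ f g k → distribˡ _ _ _
    ; homogeneous = λ a f k → solve 3 (λ x a y → x :* (a :* y) := a :* (x :* y)) refl (qint (suc k)) a (f (suc k))
    }

  iter-linear : ∀ {A} → IsLinear A → ∀ n → IsLinear (iter n A)
  iter-linear lin zero = record
    { cong = λ f≐g → f≐g ; additive = λ f g k → refl ; homogeneous = λ a f k → refl }
  iter-linear lin (suc n) = record
    { cong        = λ f≐g → cong (cong′ f≐g)
    ; additive    = λ f g k → trans (cong (additive′ f g) k) (additive _ _ k)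
    ; homogeneous = λ a f k → trans (cong (homogeneous′ a f) k) (homogeneous _ _ k)
    }
    where
    open IsLinear lin
    open IsLinear (iter-linear lin n) renaming (cong to cong′; additive to additive′; homogeneous to homogeneous′)

  iter-commute : ∀ (A : Op) n h → iter n A (A h) ≡ A (iter n A h)
  iter-commute A zero    h = P.refl
  iter-commute A (suc n) h = P.cong A (iter-commute A n h)

  Dq-X : ∀ h → Dq (X h) ≐ (λ k → q ⊗ X (Dq h) k ⊕ h k)
  Dq-X h zero    = solve 2 (λ q x → (con 0 :+ con 1) :* x := q :* con 0 :+ x) refl q (h 0)
  Dq-X h (suc k) = trans (*-congʳ (qint-suc (suc k)))
    (solve 3 (λ q Q x → (con 1 :+ q :* Q) :* x := q :* (Q :* x) :+ x) refl q (qint (suc k)) (h (suc k)))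

  Dq^b-X : ∀ b h → iter b Dq (X h) ≐ (λ k → pow q b ⊗ X (iter b Dq h) k ⊕ qint b ⊗ iter (pred b) Dq h k)
  Dq^b-X zero    h k = solve 2 (λ x y → x := con 1 :* x :+ con 0 :* y) refl (X h k) (h k)
  Dq^b-X (suc b) h k = begin
      Dq (iter b Dq (X h)) k
        ≈⟨ cong (Dq^b-X b h) k ⟩
      Dq (λ k → pow q b ⊗ X (iter b Dq h) k ⊕ qint b ⊗ iter (pred b) Dq h k) k
        ≈⟨ additive (λ k → pow q b ⊗ X (iter b Dq h) k) (λ k → qint b ⊗ iter (pred b) Dq h k) k ⟩
      Dq (λ k → pow q b ⊗ X (iter b Dq h) k) k ⊕ Dq (λ k → qint b ⊗ iter (pred b) Dq h k) k
        ≈⟨ +-cong (homogeneous (pow q b) (X (iter b Dq h)) k) (homogeneous (qint b) (iter (pred b) Dq h) k) ⟩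
      pow q b ⊗ Dq (X (iter b Dq h)) k ⊕ qint b ⊗ Dq (iter (pred b) Dq h) k
        ≈⟨ +-cong (*-congˡ (Dq-X (iter b Dq h) k)) (lower-term b) ⟩
      pow q b ⊗ (q ⊗ X (Dq (iter b Dq h)) k ⊕ iter b Dq h k) ⊕ qint b ⊗ iter b Dq h k
        ≈⟨ solve 5 (λ p q x y Q → p :* (q :* x :+ y) :+ Q :* y := (p :* q) :* x :+ (Q :+ p) :* y) refl
             (pow q b) q (X (Dq (iter b Dq h)) k) (iter b Dq h k) (qint b) ⟩
      pow q (suc b) ⊗ X (iter (suc b) Dq h) k ⊕ qint (suc b) ⊗ iter b Dq h k
        ∎
    where
    open IsLinear Dq-linear
    -- for b = 0 both sides vanish because [0] = 0
    lower-term : ∀ b → qint b ⊗ Dq (iter (pred b) Dq h) k ≈ qint b ⊗ iter b Dq h k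
    lower-term zero    = trans (zeroˡ _) (sym (zeroˡ _))
    lower-term (suc b) = refl

  XD-step : ∀ a b c h → XD a b ((X +Op (c ·Op Dq)) h) ≐
    (λ k → (pow q b ⊗ XD (suc a) b h k ⊕ qint b ⊗ XD a (pred b) h k) ⊕ c ⊗ XD a (suc b) h k)
  XD-step a b c h k = begin
      iter a X (iter b Dq (λ k → X h k ⊕ c ⊗ Dq h k)) k
        ≈⟨ Xᵃ.cong inner k ⟩
      iter a X (λ k → (pow q b ⊗ X (iter b Dq h) k ⊕ qint b ⊗ iter (pred b) Dq h k) ⊕ c ⊗ iter (suc b) Dq h k) k
        ≈⟨ trans (Xᵃ.additive _ _ k) (+-cong (trans (Xᵃ.additive _ _ k) (+-cong (Xᵃ.homogeneous _ _ k) (Xᵃ.homogeneous _ _ k)))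
                                              (Xᵃ.homogeneous _ _ k)) ⟩
      (pow q b ⊗ iter a X (X (iter b Dq h)) k ⊕ qint b ⊗ XD a (pred b) h k) ⊕ c ⊗ XD a (suc b) h k
        ≡⟨ P.cong (λ f → (pow q b ⊗ f k ⊕ qint b ⊗ XD a (pred b) h k) ⊕ c ⊗ XD a (suc b) h k)
                  (iter-commute X a (iter b Dq h)) ⟩
      (pow q b ⊗ XD (suc a) b h k ⊕ qint b ⊗ XD a (pred b) h k) ⊕ c ⊗ XD a (suc b) h k
        ∎
    where
    module Xᵃ = IsLinear (iter-linear X-linear a)
    module Dᵇ = IsLinear (iter-linear Dq-linear b)
    inner : iter b Dq (λ k → X h k ⊕ c ⊗ Dq h k) ≐
            (λ k → (pow q b ⊗ X (iter b Dq h) k ⊕ qint b ⊗ iter (pred b) Dq h k) ⊕ c ⊗ iter (suc b) Dq h k)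
    inner k = begin
      iter b Dq (λ k → X h k ⊕ c ⊗ Dq h k) k
        ≈⟨ Dᵇ.additive _ _ k ⟩
      iter b Dq (X h) k ⊕ iter b Dq (λ k → c ⊗ Dq h k) k
        ≈⟨ +-cong (Dq^b-X b h k) (Dᵇ.homogeneous c (Dq h) k) ⟩
      (pow q b ⊗ X (iter b Dq h) k ⊕ qint b ⊗ iter (pred b) Dq h k) ⊕ c ⊗ iter b Dq (Dq h) k
        ≡⟨ P.cong (λ f → (pow q b ⊗ X (iter b Dq h) k ⊕ qint b ⊗ iter (pred b) Dq h k) ⊕ c ⊗ f k)
                  (iter-commute Dq b h) ⟩
      (pow q b ⊗ X (iter b Dq h) k ⊕ qint b ⊗ iter (pred b) Dq h k) ⊕ c ⊗ iter (suc b) Dq h k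
        ∎

-- The index (n, m, j) labels the monomial X^(m-j) D_q^(n-m-j); it is a
-- genuine monomial of degree n in X and s D_q exactly when j ≤ m and m + j ≤ n.
InRange : ℕ → ℕ → ℕ → Set
InRange n m j = j ≤ m × m + j ≤ n

Outside : ℕ → ℕ → ℕ → Set
Outside n m j = m < j ⊎ n < m + j

in-or-out : ∀ n m j → InRange n m j ⊎ Outside n m j
in-or-out n m j with j ≤? m | m + j ≤? n
... | no  j≰m | _          = inj₂ (inj₁ (ℕₚ.≰⇒> j≰m))
... | yes _   | no  m+j≰n  = inj₂ (inj₂ (ℕₚ.≰⇒> m+j≰n))
... | yes j≤m | yes m+j≤n  = inj₁ (j≤m , m+j≤n)

outside-weaken : ∀ {n m j} → Outside (suc n) m j → Outside n m j
outside-weaken (inj₁ m<j)       = inj₁ m<j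
outside-weaken (inj₂ 1+n<m+j)   = inj₂ (ℕₚ.<-trans (ℕₚ.n<1+n _) 1+n<m+j)

outside-pred : ∀ {n m j} → Outside (suc n) (suc m) j → Outside n m j
outside-pred (inj₁ 1+m<j)         = inj₁ (ℕₚ.<-trans (ℕₚ.n<1+n _) 1+m<j)
outside-pred (inj₂ (s≤s 1+n≤m+j)) = inj₂ 1+n≤m+j

module Expansion {c ℓ} (K : Field c ℓ) (q s : Field.Carrier K) where
  open Field K renaming (_+_ to _⊕_; _*_ to _⊗_)
  open Ops K q
  open Cor3 K q s using (factor; lhs)
  open QCalculus K q using (≡⇒≈)
  open Sums K
  open Operators K q
  open SetoidReasoning setoid
  open NaturalCoefficients commutativeSemiring using (solve; _:+_; _:*_; _:=_)

  γ : ℕ → Carrier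
  γ n = pow q (2 * n + 1) ⊗ s

  -- E n m j is the coefficient of X^(m-j) D_q^(n-m-j) in lhs n.  By XD-step,
  -- right multiplication by X + γ n D_q feeds the coefficient at (n, m, j)
  -- into (n+1, m+1, j) with weight q^(n-m-j), into (n+1, m+1, j+1) with weight
  -- [n-m-j], and into (n+1, m, j) with weight γ n.
  mutual
    E : ℕ → ℕ → ℕ → Carrier
    E zero    zero    zero    = 1#
    E zero    zero    (suc j) = 0#
    E zero    (suc m) j       = 0#
    E (suc n) m       j       = (viaX n m j ⊕ viaD n m j) ⊕ γ n ⊗ E n m j

    viaX : ℕ → ℕ → ℕ → Carrier
    viaX n zero    j = 0#
    viaX n (suc m) j = pow q (n ∸ m ∸ j) ⊗ E n m j

    viaD : ℕ → ℕ → ℕ → Carrier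
    viaD n zero    j       = 0#
    viaD n (suc m) zero    = 0#
    viaD n (suc m) (suc j) = qint (n ∸ m ∸ j) ⊗ E n m j

  E-outside : ∀ n m j → Outside n m j → E n m j ≈ 0#
  E-outside zero zero    zero    (inj₁ ())
  E-outside zero zero    zero    (inj₂ ())
  E-outside zero zero    (suc j) _ = refl
  E-outside zero (suc m) j       _ = refl
  E-outside (suc n) m j out = begin
      (viaX n m j ⊕ viaD n m j) ⊕ γ n ⊗ E n m j
        ≈⟨ +-cong (+-cong (viaX-outside m out) (viaD-outside m j out))
                  (trans (*-congˡ (E-outside n m j (outside-weaken out))) (zeroʳ _)) ⟩
      (0# ⊕ 0#) ⊕ 0#
        ≈⟨ trans (+-identityʳ _) (+-identityʳ _) ⟩
      0# ∎
    where
    viaX-outside : ∀ m → Outside (suc n) m j → viaX n m j ≈ 0#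
    viaX-outside zero    _   = refl
    viaX-outside (suc m) out = trans (*-congˡ (E-outside n m j (outside-pred out))) (zeroʳ _)
    -- on the boundary m + j = n the weight [n-m-j] = [0] vanishes
    viaD-outside : ∀ m j → Outside (suc n) m j → viaD n m j ≈ 0#
    viaD-outside zero    j       _ = refl
    viaD-outside (suc m) zero    _ = refl
    viaD-outside (suc m) (suc j) (inj₁ (s≤s m<j)) = trans (*-congˡ (E-outside n m j (inj₁ m<j))) (zeroʳ _)
    viaD-outside (suc m) (suc j) (inj₂ (s≤s n<m+1+j))
      with ℕₚ.m≤n⇒m<n∨m≡n (s≤s⁻¹ (P.subst (suc n ≤_) (ℕₚ.+-suc m j) n<m+1+j))
    ... | inj₁ n<m+j  = trans (*-congˡ (E-outside n m j (inj₂ n<m+j))) (zeroʳ _)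
    ... | inj₂ P.refl = trans (*-congʳ (≡⇒≈ (P.cong qint m+j∸m∸j≡0))) (zeroˡ _)
      where
      m+j∸m∸j≡0 : m + j ∸ m ∸ j ≡ 0
      m+j∸m∸j≡0 = P.trans (P.cong (_∸ j) (ℕₚ.m+n∸m≡n m j)) (ℕₚ.n∸n≡0 j)

  W : ℕ → Seq → ℕ → ℕ → ℕ → Carrier
  W n h k m j = XD (m ∸ j) (n ∸ m ∸ j) h k

  Σ² : ℕ → (ℕ → ℕ → Carrier) → Carrier
  Σ² N F = Sum N (λ m → Sum N (λ j → F m j))

  Σ²-+₃ : ∀ N (F G H : ℕ → ℕ → Carrier) →
    Σ² N (λ m j → (F m j ⊕ G m j) ⊕ H m j) ≈ (Σ² N F ⊕ Σ² N G) ⊕ Σ² N H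
  Σ²-+₃ N F G H = trans (Sum-cong N (λ m → trans (Sum-+ N _ _) (+-congʳ (Sum-+ N _ _))))
                        (trans (Sum-+ N _ _) (+-congʳ (Sum-+ N _ _)))

  expansion : ℕ → Seq → ℕ → Carrier
  expansion n h k = Σ² n (λ m j → E n m j ⊗ W n h k m j)

  move-weight : ∀ n m j a {w w′} → (InRange n m j → w ≡ w′) → (a ⊗ E n m j) ⊗ w ≈ E n m j ⊗ (a ⊗ w′)
  move-weight n m j a {w} {w′} agree with in-or-out n m j
  ... | inj₁ inRange = P.subst (λ v → (a ⊗ E n m j) ⊗ w ≈ E n m j ⊗ (a ⊗ v)) (agree inRange)
                         (solve 3 (λ a e w → (a :* e) :* w := e :* (a :* w)) refl a (E n m j) w)
  ... | inj₂ outside = begin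
      (a ⊗ E n m j) ⊗ w   ≈⟨ *-congʳ (trans (*-congˡ E≈0) (zeroʳ a)) ⟩
      0# ⊗ w              ≈⟨ zeroˡ w ⟩
      0#                  ≈⟨ sym (zeroˡ _) ⟩
      0# ⊗ (a ⊗ w′)       ≈⟨ *-congʳ (sym E≈0) ⟩
      E n m j ⊗ (a ⊗ w′)  ∎
    where
    E≈0 : E n m j ≈ 0#
    E≈0 = E-outside n m j outside

  E-last-row : ∀ n j x → E n (suc n) j ⊗ x ≈ 0#
  E-last-row n j x = trans (*-congʳ (E-outside n (suc n) j (inj₂ (ℕₚ.m≤m+n (suc n) j)))) (zeroˡ x)

  E-last-column : ∀ n m x → E n m (suc n) ⊗ x ≈ 0#
  E-last-column n m x = trans (*-congʳ (E-outside n m (suc n) (inj₂ (ℕₚ.m≤n+m (suc n) m)))) (zeroˡ x)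

  via-X-sum : ∀ n h k → Σ² (suc n) (λ m j → viaX n m j ⊗ W (suc n) h k m j)
                      ≈ Σ² n (λ m j → E n m j ⊗ (pow q (n ∸ m ∸ j) ⊗ XD (suc (m ∸ j)) (n ∸ m ∸ j) h k))
  via-X-sum n h k = trans (Sum-drop-first n (Sum-zero (suc n) (λ j → zeroˡ _))) (Sum-cong n row)
    where
    row : ∀ m → Sum (suc n) (λ j → viaX n (suc m) j ⊗ W (suc n) h k (suc m) j)
              ≈ Sum n (λ j → E n m j ⊗ (pow q (n ∸ m ∸ j) ⊗ XD (suc (m ∸ j)) (n ∸ m ∸ j) h k))
    row m = trans (Sum-drop-last n (trans (*-assoc _ _ _) (trans (*-congˡ (E-last-column n m _)) (zeroʳ _))))
                  (Sum-cong n (λ j → move-weight n m j _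
                    (λ (j≤m , _) → P.cong (λ a → XD a (n ∸ m ∸ j) h k) (ℕₚ.+-∸-assoc 1 j≤m))))

  via-D-sum : ∀ n h k → Σ² (suc n) (λ m j → viaD n m j ⊗ W (suc n) h k m j)
                      ≈ Σ² n (λ m j → E n m j ⊗ (qint (n ∸ m ∸ j) ⊗ XD (m ∸ j) (pred (n ∸ m ∸ j)) h k))
  via-D-sum n h k = trans (Sum-drop-first n (Sum-zero (suc n) (λ j → zeroˡ _))) (Sum-cong n row)
    where
    row : ∀ m → Sum (suc n) (λ j → viaD n (suc m) j ⊗ W (suc n) h k (suc m) j)
              ≈ Sum n (λ j → E n m j ⊗ (qint (n ∸ m ∸ j) ⊗ XD (m ∸ j) (pred (n ∸ m ∸ j)) h k))
    row m = trans (Sum-drop-first n (zeroˡ _))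
                  (Sum-cong n (λ j → move-weight n m j _
                    (λ _ → P.cong (λ b → XD (m ∸ j) b h k) (P.sym (ℕₚ.pred[m∸n]≡m∸[1+n] (n ∸ m) j)))))

  via-γ-sum : ∀ n h k → Σ² (suc n) (λ m j → (γ n ⊗ E n m j) ⊗ W (suc n) h k m j)
                      ≈ Σ² n (λ m j → E n m j ⊗ (γ n ⊗ XD (m ∸ j) (suc (n ∸ m ∸ j)) h k))
  via-γ-sum n h k = trans (Sum-drop-last n (Sum-zero (suc n) (λ j → last-row j))) (Sum-cong n row)
    where
    last-row : ∀ j → (γ n ⊗ E n (suc n) j) ⊗ W (suc n) h k (suc n) j ≈ 0#
    last-row j = trans (*-assoc _ _ _) (trans (*-congˡ (E-last-row n j _)) (zeroʳ _))
    1+n∸m∸j : ∀ m j → m + j ≤ n → suc n ∸ m ∸ j ≡ suc (n ∸ m ∸ j)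
    1+n∸m∸j m j m+j≤n = P.trans (ℕₚ.∸-+-assoc (suc n) m j)
                       (P.trans (ℕₚ.+-∸-assoc 1 m+j≤n) (P.cong suc (P.sym (ℕₚ.∸-+-assoc n m j))))
    row : ∀ m → Sum (suc n) (λ j → (γ n ⊗ E n m j) ⊗ W (suc n) h k m j)
              ≈ Sum n (λ j → E n m j ⊗ (γ n ⊗ XD (m ∸ j) (suc (n ∸ m ∸ j)) h k))
    row m = trans (Sum-drop-last n (trans (*-assoc _ _ _) (trans (*-congˡ (E-last-column n m _)) (zeroʳ _))))
                  (Sum-cong n (λ j → move-weight n m j _
                    (λ (_ , m+j≤n) → P.cong (λ b → XD (m ∸ j) b h k) (1+n∸m∸j m j m+j≤n))))

  lhs-expansion : ∀ n h k → lhs n h k ≈ expansion n h k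
  lhs-expansion zero    h k = sym (*-identityˡ (h k))
  lhs-expansion (suc n) h k = begin
      lhs n (factor n h) k
        ≈⟨ lhs-expansion n (factor n h) k ⟩
      Σ² n (λ m j → E n m j ⊗ W n (factor n h) k m j)
        ≈⟨ Sum-cong n (λ m → Sum-cong n (λ j → trans (*-congˡ (XD-step (m ∸ j) (n ∸ m ∸ j) (γ n) h k))
             (solve 4 (λ e x y z → e :* ((x :+ y) :+ z) := (e :* x :+ e :* y) :+ e :* z) refl _ _ _ _))) ⟩
      Σ² n (λ m j → (E n m j ⊗ (pow q (n ∸ m ∸ j) ⊗ XD (suc (m ∸ j)) (n ∸ m ∸ j) h k)
                     ⊕ E n m j ⊗ (qint (n ∸ m ∸ j) ⊗ XD (m ∸ j) (pred (n ∸ m ∸ j)) h k))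
                     ⊕ E n m j ⊗ (γ n ⊗ XD (m ∸ j) (suc (n ∸ m ∸ j)) h k))
        ≈⟨ Σ²-+₃ n _ _ _ ⟩
      (Σ² n (λ m j → E n m j ⊗ (pow q (n ∸ m ∸ j) ⊗ XD (suc (m ∸ j)) (n ∸ m ∸ j) h k))
        ⊕ Σ² n (λ m j → E n m j ⊗ (qint (n ∸ m ∸ j) ⊗ XD (m ∸ j) (pred (n ∸ m ∸ j)) h k)))
        ⊕ Σ² n (λ m j → E n m j ⊗ (γ n ⊗ XD (m ∸ j) (suc (n ∸ m ∸ j)) h k))
        ≈⟨ sym (+-cong (+-cong (via-X-sum n h k) (via-D-sum n h k)) (via-γ-sum n h k)) ⟩
      (Σ² (suc n) (λ m j → viaX n m j ⊗ W (suc n) h k m j)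
        ⊕ Σ² (suc n) (λ m j → viaD n m j ⊗ W (suc n) h k m j))
        ⊕ Σ² (suc n) (λ m j → (γ n ⊗ E n m j) ⊗ W (suc n) h k m j)
        ≈⟨ sym (Σ²-+₃ (suc n) _ _ _) ⟩
      Σ² (suc n) (λ m j → (viaX n m j ⊗ W (suc n) h k m j ⊕ viaD n m j ⊗ W (suc n) h k m j)
                          ⊕ (γ n ⊗ E n m j) ⊗ W (suc n) h k m j)
        ≈⟨ Sum-cong (suc n) (λ m → Sum-cong (suc n) (λ j →
             solve 4 (λ a b c w → (a :* w :+ b :* w) :+ c :* w := ((a :+ b) :+ c) :* w) refl _ _ _ _)) ⟩
      expansion (suc n) h k ∎

-- Closed form of the coefficients: writing m = j + a and n = m + j + b,
--   (1+q)⋯(1+q^j) [j]! [a]! [b]! · E n m j = q^(nb + j²) [n]! s^(b+j).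
module ClosedForm {c ℓ} (K : Field c ℓ) (q s : Field.Carrier K) where
  open Field K renaming (_+_ to _⊕_; _*_ to _⊗_)
  open Ops K q
  open QCalculus K q
  open Expansion K q s
  open SetoidReasoning setoid
  open NaturalCoefficients commutativeSemiring using (solve; _:+_; _:*_; _:=_; con)

  Den : ℕ → ℕ → ℕ → Carrier
  Den j a b = onePlusProd j ⊗ qfact j ⊗ qfact a ⊗ qfact b

  Num : ℕ → ℕ → ℕ → Carrier
  Num n b j = pow q (n * b + j * j) ⊗ qfact n ⊗ pow s (b + j)

  Den-suc-a : ∀ j a b → Den j (suc a) b ≈ qint (suc a) ⊗ Den j a b
  Den-suc-a j a b = solve 5 (λ O Fj Fa Qa Fb → ((O :* Fj) :* (Fa :* Qa)) :* Fb := Qa :* (((O :* Fj) :* Fa) :* Fb))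
                      refl (onePlusProd j) (qfact j) (qfact a) (qint (suc a)) (qfact b)

  Den-suc-b : ∀ j a b → Den j a (suc b) ≈ qint (suc b) ⊗ Den j a b
  Den-suc-b j a b = solve 5 (λ O Fj Fa Fb Qb → ((O :* Fj) :* Fa) :* (Fb :* Qb) := Qb :* (((O :* Fj) :* Fa) :* Fb))
                      refl (onePlusProd j) (qfact j) (qfact a) (qfact b) (qint (suc b))

  Den-suc-j : ∀ j a b → Den (suc j) a b ⊗ qint (suc b) ≈ ((1# ⊕ pow q (suc j)) ⊗ qint (suc j)) ⊗ Den j a (suc b)
  Den-suc-j j a b = solve 7 (λ O P Fj Qj Fa Fb Qb → (((O :* P) :* (Fj :* Qj)) :* Fa) :* Fb :* Qb
                                                  := (P :* Qj) :* (((O :* Fj) :* Fa) :* (Fb :* Qb)))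
                      refl (onePlusProd j) (1# ⊕ pow q (suc j)) (qfact j) (qint (suc j)) (qfact a) (qfact b) (qint (suc b))

  Num-suc-j : ∀ n j a b → n ≡ j + a + j + suc b → Num n (suc b) j ≈ pow q (a + b) ⊗ Num n b (suc j)
  Num-suc-j n j a b P.refl = begin
      pow q (n * suc b + j * j) ⊗ qfact n ⊗ pow s (suc b + j)
        ≈⟨ *-cong (*-congʳ (≡⇒≈ (P.cong (pow q) (exponent j a b)))) (≡⇒≈ (P.cong (pow s) (P.sym (ℕₚ.+-suc b j)))) ⟩
      pow q ((a + b) + (n * b + suc j * suc j)) ⊗ qfact n ⊗ pow s (b + suc j)
        ≈⟨ *-congʳ (*-congʳ (pow-+ q (a + b) _)) ⟩
      (pow q (a + b) ⊗ pow q (n * b + suc j * suc j)) ⊗ qfact n ⊗ pow s (b + suc j)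
        ≈⟨ solve 4 (λ x y z w → (x :* y) :* z :* w := x :* (y :* z :* w)) refl _ _ _ _ ⟩
      pow q (a + b) ⊗ Num n b (suc j) ∎
    where
    exponent : ∀ j a b → (j + a + j + suc b) * suc b + j * j
                         ≡ (a + b) + ((j + a + j + suc b) * b + suc j * suc j)
    exponent = solve-∀

  Num-suc-b : ∀ n b j → γ n ⊗ Num n b j ≈ pow q (suc n) ⊗ Num n (suc b) j
  Num-suc-b n b j = begin
      (pow q (2 * n + 1) ⊗ s) ⊗ (pow q (n * b + j * j) ⊗ qfact n ⊗ pow s (b + j))
        ≈⟨ solve 5 (λ x y z w v → (x :* y) :* (z :* w :* v) := (x :* z) :* w :* (v :* y)) refl _ _ _ _ _ ⟩
      (pow q (2 * n + 1) ⊗ pow q (n * b + j * j)) ⊗ qfact n ⊗ (pow s (b + j) ⊗ s)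
        ≈⟨ *-congʳ (*-congʳ (sym (pow-+ q (2 * n + 1) (n * b + j * j)))) ⟩
      pow q ((2 * n + 1) + (n * b + j * j)) ⊗ qfact n ⊗ (pow s (b + j) ⊗ s)
        ≈⟨ *-congʳ (*-congʳ (≡⇒≈ (P.cong (pow q) (exponent n b j)))) ⟩
      pow q (suc n + (n * suc b + j * j)) ⊗ qfact n ⊗ (pow s (b + j) ⊗ s)
        ≈⟨ *-congʳ (*-congʳ (pow-+ q (suc n) (n * suc b + j * j))) ⟩
      (pow q (suc n) ⊗ pow q (n * suc b + j * j)) ⊗ qfact n ⊗ (pow s (b + j) ⊗ s)
        ≈⟨ solve 4 (λ x y z w → (x :* y) :* z :* w := x :* (y :* z :* w)) refl _ _ _ _ ⟩
      pow q (suc n) ⊗ Num n (suc b) j ∎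
    where
    exponent : ∀ n b j → (2 * n + 1) + (n * b + j * j) ≡ suc n + (n * suc b + j * j)
    exponent = solve-∀

  Num-suc-n : ∀ n b j → (pow q b ⊗ qint (suc n)) ⊗ Num n b j ≈ Num (suc n) b j
  Num-suc-n n b j = begin
      (pow q b ⊗ qint (suc n)) ⊗ (pow q (n * b + j * j) ⊗ qfact n ⊗ pow s (b + j))
        ≈⟨ solve 5 (λ x y z w v → (x :* y) :* (z :* w :* v) := (x :* z) :* (w :* y) :* v) refl _ _ _ _ _ ⟩
      (pow q b ⊗ pow q (n * b + j * j)) ⊗ (qfact n ⊗ qint (suc n)) ⊗ pow s (b + j)
        ≈⟨ *-congʳ (*-congʳ (sym (pow-+ q b (n * b + j * j)))) ⟩
      pow q (b + (n * b + j * j)) ⊗ (qfact n ⊗ qint (suc n)) ⊗ pow s (b + j)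
        ≈⟨ *-congʳ (*-congʳ (≡⇒≈ (P.cong (pow q) (P.sym (exponent n b j))))) ⟩
      Num (suc n) b j ∎
    where
    exponent : ∀ n b j → suc n * b + j * j ≡ b + (n * b + j * j)
    exponent = solve-∀

  both-vanish : ∀ {x y} d v → x ≈ 0# → y ≈ 0# → d ⊗ x ≈ y ⊗ v
  both-vanish d v x≈0 y≈0 = trans (*-congˡ x≈0) (trans (zeroʳ d) (sym (trans (*-congʳ y≈0) (zeroˡ v))))

  m+j+b∸m∸j≡b : ∀ m j b → m + j + b ∸ m ∸ j ≡ b
  m+j+b∸m∸j≡b m j b = P.trans (P.cong (_∸ j) (P.trans (P.cong (_∸ m) (ℕₚ.+-assoc m j b)) (ℕₚ.m+n∸m≡n m (j + b))))
                              (ℕₚ.m+n∸m≡n j b)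

  ClosedFormAt : ℕ → Set ℓ
  ClosedFormAt n = ∀ m j a b → m ≡ j + a → n ≡ m + j + b → Den j a b ⊗ E n m j ≈ Num n b j

  -- Assuming the closed form at level n, each of the three contributions to
  -- E (n+1) m j is a multiple of Num n b j; the three weights sum to
  -- q^b [n+1] by q-pascal.
  viaX-closed : ∀ {n} → ClosedFormAt n → ∀ m j a b → m ≡ j + a → suc n ≡ m + j + b →
                Den j a b ⊗ viaX n m j ≈ (qint a ⊗ pow q b) ⊗ Num n b j
  viaX-closed ih zero    zero    zero    b _ _ = both-vanish _ _ refl (zeroˡ _)
  viaX-closed {n} ih (suc m) j zero b m+1≡j+0 _ =
    both-vanish _ _ (trans (*-congˡ (E-outside n m j (inj₁ m<j))) (zeroʳ _)) (zeroˡ _)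
    where
    m<j : m < j
    m<j = ℕₚ.≤-reflexive (P.trans m+1≡j+0 (ℕₚ.+-identityʳ j))
  viaX-closed {n} ih (suc m) j (suc a) b m+1≡j+a+1 n+1≡m+1+j+b = begin
      Den j (suc a) b ⊗ (pow q (n ∸ m ∸ j) ⊗ E n m j)
        ≈⟨ *-cong (Den-suc-a j a b) (*-congʳ (≡⇒≈ (P.cong (pow q) n∸m∸j≡b))) ⟩
      (qint (suc a) ⊗ Den j a b) ⊗ (pow q b ⊗ E n m j)
        ≈⟨ solve 4 (λ Q D P e → (Q :* D) :* (P :* e) := (Q :* P) :* (D :* e)) refl _ _ _ _ ⟩
      (qint (suc a) ⊗ pow q b) ⊗ (Den j a b ⊗ E n m j)
        ≈⟨ *-congˡ (ih m j a b m≡j+a n≡m+j+b) ⟩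
      (qint (suc a) ⊗ pow q b) ⊗ Num n b j ∎
    where
    m≡j+a : m ≡ j + a
    m≡j+a = ℕₚ.suc-injective (P.trans m+1≡j+a+1 (ℕₚ.+-suc j a))
    n≡m+j+b : n ≡ m + j + b
    n≡m+j+b = ℕₚ.suc-injective n+1≡m+1+j+b
    n∸m∸j≡b : n ∸ m ∸ j ≡ b
    n∸m∸j≡b = P.trans (P.cong (λ n → n ∸ m ∸ j) n≡m+j+b) (m+j+b∸m∸j≡b m j b)

  viaD-closed : ∀ {n} → ClosedFormAt n → ∀ m j a b → m ≡ j + a → suc n ≡ m + j + b →
                Den j a b ⊗ viaD n m j ≈ (qint (j + j) ⊗ pow q (a + b)) ⊗ Num n b j
  viaD-closed ih zero    zero    a b _ _ = both-vanish _ _ refl (zeroˡ _)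
  viaD-closed ih (suc m) zero    a b _ _ = both-vanish _ _ refl (zeroˡ _)
  viaD-closed {n} ih (suc m) (suc j) a b m+1≡j+1+a n+1≡m+1+j+1+b = begin
      Den (suc j) a b ⊗ (qint (n ∸ m ∸ j) ⊗ E n m j)
        ≈⟨ trans (*-congˡ (*-congʳ (≡⇒≈ (P.cong qint n∸m∸j≡1+b)))) (sym (*-assoc _ _ _)) ⟩
      (Den (suc j) a b ⊗ qint (suc b)) ⊗ E n m j
        ≈⟨ trans (*-congʳ (Den-suc-j j a b)) (*-assoc _ _ _) ⟩
      ((1# ⊕ pow q (suc j)) ⊗ qint (suc j)) ⊗ (Den j a (suc b) ⊗ E n m j)
        ≈⟨ *-cong (qint-double (suc j)) (ih m j a (suc b) m≡j+a n≡m+j+b+1) ⟩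
      qint (suc j + suc j) ⊗ Num n (suc b) j
        ≈⟨ *-congˡ (Num-suc-j n j a b (P.trans n≡m+j+b+1 (P.cong (λ m → m + j + suc b) m≡j+a))) ⟩
      qint (suc j + suc j) ⊗ (pow q (a + b) ⊗ Num n b (suc j))
        ≈⟨ sym (*-assoc _ _ _) ⟩
      (qint (suc j + suc j) ⊗ pow q (a + b)) ⊗ Num n b (suc j) ∎
    where
    m≡j+a : m ≡ j + a
    m≡j+a = ℕₚ.suc-injective m+1≡j+1+a
    n≡m+j+b+1 : n ≡ m + j + suc b
    n≡m+j+b+1 = ℕₚ.suc-injective (P.trans n+1≡m+1+j+1+b (shift m j b))
      where
      shift : ∀ m j b → suc m + suc j + b ≡ suc (m + j + suc b)
      shift = solve-∀
    n∸m∸j≡1+b : n ∸ m ∸ j ≡ suc b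
    n∸m∸j≡1+b = P.trans (P.cong (λ n → n ∸ m ∸ j) n≡m+j+b+1) (m+j+b∸m∸j≡b m j (suc b))

  viaγ-closed : ∀ {n} → ClosedFormAt n → ∀ m j a b → m ≡ j + a → suc n ≡ m + j + b →
                Den j a b ⊗ (γ n ⊗ E n m j) ≈ (pow q (suc n) ⊗ qint b) ⊗ Num n b j
  viaγ-closed {n} ih m j a zero _ n+1≡m+j+0 =
    both-vanish _ _ (trans (*-congˡ (E-outside n m j (inj₂ n<m+j))) (zeroʳ _)) (zeroʳ _)
    where
    n<m+j : n < m + j
    n<m+j = ℕₚ.≤-reflexive (P.trans n+1≡m+j+0 (ℕₚ.+-identityʳ _))
  viaγ-closed {n} ih m j a (suc b) m≡j+a n+1≡m+j+b+1 = begin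
      Den j a (suc b) ⊗ (γ n ⊗ E n m j)
        ≈⟨ *-congʳ (Den-suc-b j a b) ⟩
      (qint (suc b) ⊗ Den j a b) ⊗ (γ n ⊗ E n m j)
        ≈⟨ solve 4 (λ Q D g e → (Q :* D) :* (g :* e) := Q :* (g :* (D :* e))) refl _ _ _ _ ⟩
      qint (suc b) ⊗ (γ n ⊗ (Den j a b ⊗ E n m j))
        ≈⟨ *-congˡ (*-congˡ (ih m j a b m≡j+a n≡m+j+b)) ⟩
      qint (suc b) ⊗ (γ n ⊗ Num n b j)
        ≈⟨ *-congˡ (Num-suc-b n b j) ⟩
      qint (suc b) ⊗ (pow q (suc n) ⊗ Num n (suc b) j)
        ≈⟨ solve 3 (λ x y z → x :* (y :* z) := (y :* x) :* z) refl _ _ _ ⟩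
      (pow q (suc n) ⊗ qint (suc b)) ⊗ Num n (suc b) j ∎
    where
    n≡m+j+b : n ≡ m + j + b
    n≡m+j+b = ℕₚ.suc-injective (P.trans n+1≡m+j+b+1 (ℕₚ.+-suc (m + j) b))

  closed-form : ∀ n → ClosedFormAt n
  closed-form zero zero zero zero zero P.refl P.refl =
    solve 0 ((((con 1 :* con 1) :* con 1) :* con 1) :* con 1 := (con 1 :* con 1) :* con 1) refl
  closed-form zero zero    zero    (suc a) b       () _
  closed-form zero zero    zero    zero    (suc b) _ ()
  closed-form zero zero    (suc j) a       b       _ ()
  closed-form zero (suc m) j       a       b       _ ()
  closed-form (suc n) m j a b m≡j+a n+1≡m+j+b = begin
      Den j a b ⊗ ((viaX n m j ⊕ viaD n m j) ⊕ γ n ⊗ E n m j)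
        ≈⟨ solve 5 (λ D x y z w → D :* ((x :+ y) :+ z :* w) := (D :* x :+ D :* y) :+ D :* (z :* w)) refl _ _ _ _ _ ⟩
      (Den j a b ⊗ viaX n m j ⊕ Den j a b ⊗ viaD n m j) ⊕ Den j a b ⊗ (γ n ⊗ E n m j)
        ≈⟨ +-cong (+-cong (viaX-closed ih m j a b m≡j+a n+1≡m+j+b) (viaD-closed ih m j a b m≡j+a n+1≡m+j+b))
                  (viaγ-closed ih m j a b m≡j+a n+1≡m+j+b) ⟩
      ((qint a ⊗ pow q b) ⊗ Num n b j ⊕ (qint (j + j) ⊗ pow q (a + b)) ⊗ Num n b j) ⊕ (pow q (suc n) ⊗ qint b) ⊗ Num n b j
        ≈⟨ solve 4 (λ x y z w → (x :* w :+ y :* w) :+ z :* w := ((x :+ y) :+ z) :* w) refl _ _ _ _ ⟩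
      ((qint a ⊗ pow q b ⊕ qint (j + j) ⊗ pow q (a + b)) ⊕ pow q (suc n) ⊗ qint b) ⊗ Num n b j
        ≈⟨ *-congʳ weights ⟩
      (pow q b ⊗ qint (suc n)) ⊗ Num n b j
        ≈⟨ Num-suc-n n b j ⟩
      Num (suc n) b j ∎
    where
    ih : ClosedFormAt n
    ih = closed-form n
    n+1≡a+2j+b : suc n ≡ a + (j + j) + b
    n+1≡a+2j+b = P.trans n+1≡m+j+b (P.trans (P.cong (λ m → m + j + b) m≡j+a) (regroup j a b))
      where
      regroup : ∀ j a b → j + a + j + b ≡ a + (j + j) + b
      regroup = solve-∀
    weights : (qint a ⊗ pow q b ⊕ qint (j + j) ⊗ pow q (a + b)) ⊕ pow q (suc n) ⊗ qint b ≈ pow q b ⊗ qint (suc n)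
    weights = P.subst (λ N → (qint a ⊗ pow q b ⊕ qint (j + j) ⊗ pow q (a + b)) ⊕ pow q N ⊗ qint b ≈ pow q b ⊗ qint N)
                      (P.sym n+1≡a+2j+b) (q-pascal a j b)

min-bound-in : ∀ {n m j} → m ≤ n → j ≤ m ⊓ (n ∸ m) → InRange n m j
min-bound-in {n} {m} {j} m≤n j≤min =
  ( ℕₚ.≤-trans j≤min (ℕₚ.m⊓n≤m m (n ∸ m))
  , ℕₚ.≤-trans (ℕₚ.+-monoʳ-≤ m (ℕₚ.≤-trans j≤min (ℕₚ.m⊓n≤n m (n ∸ m)))) (ℕₚ.≤-reflexive (ℕₚ.m+[n∸m]≡n m≤n)) )

min-bound-out : ∀ {n m j} → m ⊓ (n ∸ m) < j → Outside n m j
min-bound-out {n} {m} {j} min<j with in-or-out n m j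
... | inj₂ outside         = outside
... | inj₁ (j≤m , m+j≤n)   = contradiction (ℕₚ.⊓-glb j≤m j≤n∸m) (ℕₚ.<⇒≱ min<j)
  where
  j≤n∸m : j ≤ n ∸ m
  j≤n∸m = ℕₚ.m+n≤o⇒m≤o∸n j (P.subst (_≤ n) (ℕₚ.+-comm m j) m+j≤n)

module Identification {c ℓ} (K : Field c ℓ) (q s : Field.Carrier K) where
  open Field K renaming (_+_ to _⊕_; _*_ to _⊗_)
  open Ops K q
  open Cor3 K q s using (coeff; rhs)
  open FieldFacts K
  open QCalculus K q using (≡⇒≈)
  open Sums K
  open Expansion K q s
  open ClosedForm K q s
  open SetoidReasoning setoid

  sumOp-Sum : ∀ N F f k → sumOp N F f k ≡ Sum N (λ i → F i f k)
  sumOp-Sum zero    F f k = P.refl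
  sumOp-Sum (suc N) F f k = P.cong (_⊕ F (suc N) f k) (sumOp-Sum N F f k)

  module _ (qint-nonzero    : ∀ k → ¬ qint (suc k) ≈ 0#)
           (onePlus-nonzero : ∀ k → ¬ (1# ⊕ pow q (suc k)) ≈ 0#) where

    qfact-nonzero : ∀ k → ¬ qfact k ≈ 0#
    qfact-nonzero zero    = 1≉0
    qfact-nonzero (suc k) = ⊗-nonzero (qfact-nonzero k) (qint-nonzero k)

    onePlusProd-nonzero : ∀ j → ¬ onePlusProd j ≈ 0#
    onePlusProd-nonzero zero    = 1≉0
    onePlusProd-nonzero (suc j) = ⊗-nonzero (onePlusProd-nonzero j) (onePlus-nonzero j)

    Den-nonzero : ∀ j a b → ¬ Den j a b ≈ 0#
    Den-nonzero j a b =
      ⊗-nonzero (⊗-nonzero (⊗-nonzero (onePlusProd-nonzero j) (qfact-nonzero j)) (qfact-nonzero a)) (qfact-nonzero b)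

    E≈coeff : ∀ n m j → InRange n m j → E n m j ≈ coeff n m j
    E≈coeff n m j (j≤m , m+j≤n) = begin
        E n m j
          ≈⟨ divide (Den-nonzero j a b) (closed-form n m j a b m≡j+a n≡m+j+b) ⟩
        Num n b j ⊗ Den j a b ⁻¹
          ≈⟨ *-congʳ (*-cong (*-congʳ (≡⇒≈ (P.cong (pow q) exponent))) (≡⇒≈ (P.cong (pow s) b+j≡n∸m))) ⟩
        coeff n m j ∎
      where
      a = m ∸ j
      b = n ∸ m ∸ j
      m≡j+a : m ≡ j + a
      m≡j+a = P.sym (ℕₚ.m+[n∸m]≡n j≤m)
      n≡m+j+b : n ≡ m + j + b
      n≡m+j+b = P.sym (P.trans (P.cong (m + j +_) (ℕₚ.∸-+-assoc n m j)) (ℕₚ.m+[n∸m]≡n m+j≤n))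
      b+j≡n∸m : b + j ≡ n ∸ m
      b+j≡n∸m = P.sym (P.trans (P.cong (_∸ m) n≡m+j+b)
                (P.trans (P.cong (_∸ m) (ℕₚ.+-assoc m j b)) (P.trans (ℕₚ.m+n∸m≡n m (j + b)) (ℕₚ.+-comm j b))))
      -- n² + j² - (m+j)n = nb + j², since n = (m+j) + b
      split-square : ∀ M b j → (M + b) * (M + b) + j * j ≡ M * (M + b) + ((M + b) * b + j * j)
      split-square = solve-∀
      exponent : n * b + j * j ≡ (n * n + j * j) ∸ (m + j) * n
      exponent = P.sym (P.subst (λ N → (N * N + j * j) ∸ (m + j) * N ≡ N * b + j * j) (P.sym n≡m+j+b)
                          (P.trans (P.cong (_∸ ((m + j) * (m + j + b))) (split-square (m + j) b j))
                                   (ℕₚ.m+n∸m≡n ((m + j) * (m + j + b)) _)))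

    expansion-row : ∀ n h k m → m ≤ n →
      Sum n (λ j → E n m j ⊗ W n h k m j) ≈ Sum (m ⊓ (n ∸ m)) (λ j → coeff n m j ⊗ W n h k m j)
    expansion-row n h k m m≤n = trans
      (Sum-truncate n (ℕₚ.≤-trans (ℕₚ.m⊓n≤n m (n ∸ m)) (ℕₚ.m∸n≤m n m))
        (λ j min<j → trans (*-congʳ (E-outside n m j (min-bound-out min<j))) (zeroˡ _)))
      (Sum-cong≤ (m ⊓ (n ∸ m)) (λ j j≤min → *-congʳ (E≈coeff n m j (min-bound-in m≤n j≤min))))

    expansion≈rhs : ∀ n h k → expansion n h k ≈ rhs n h k
    expansion≈rhs n h k = begin
      expansion n h k
        ≈⟨ Sum-cong≤ n (λ m m≤n → expansion-row n h k m m≤n) ⟩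
      Sum n (λ m → Sum (m ⊓ (n ∸ m)) (λ j → coeff n m j ⊗ W n h k m j))
        ≈⟨ sym (Sum-cong n (λ m → ≡⇒≈ (sumOp-Sum (m ⊓ (n ∸ m)) (λ j → coeff n m j ·Op XD (m ∸ j) (n ∸ m ∸ j)) h k))) ⟩
      Sum n (λ m → sumOp (m ⊓ (n ∸ m)) (λ j → coeff n m j ·Op XD (m ∸ j) (n ∸ m ∸ j)) h k)
        ≡⟨ P.sym (sumOp-Sum n _ h k) ⟩
      rhs n h k ∎

-- The product formula: lhs n equals its expansion, which equals rhs n.
corollary3 : ∀ {c ℓ} (K : Field c ℓ) (q s : Field.Carrier K) →
    (∀ k → ¬ Field._≈_ K (Ops.qint K q (suc k)) (Field.0# K)) →
    (∀ k → ¬ Field._≈_ K (Field._+_ K (Field.1# K) (Ops.pow K q q (suc k))) (Field.0# K)) →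
    ∀ (n : ℕ) (f : Ops.Seq K q) → Ops.IsPolynomial K q f → ∀ (k : ℕ) →
    Field._≈_ K (Cor3.lhs K q s n f k) (Cor3.rhs K q s n f k)
corollary3 K q s qint-nonzero onePlus-nonzero n f _ k =
  Field.trans K (Expansion.lhs-expansion K q s n f k)
                (Identification.expansion≈rhs K q s qint-nonzero onePlus-nonzero n f k)
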